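{- Let $M=M(S)$ be a matroid of rank $r$ on a linearly ordered set $S=\{e_1<\dots<e_n\}$, with distinguished word $w_{M(S)}\in W_{n,r}$. If $v\le w_{M(S)}$ in $W_{n,r}$, then $\lambda_M(\sigma_{A,B})=v$, where $A=\pi(w_{M(S)})$ and $B=\pi(v)$.
   Context: $W_{n,r}$ is the set of words of length $n$ on $\{0,1\}$ with $r$ ones; $\pi_k(w)$ is the position of the $k$-th $1$; $v\le w$ iff $\pi_k(v)\le\pi_k(w)$ for all $k$; $\pi(w)=\{e_{\pi_1(w)},\dots,e_{\pi_r(w)}\}$. The distinguished word of a matroid on a linearly ordered set $\{f_1<\dots<f_n\}$ is $x_1\cdots x_n$ with $x_i=0$ if $f_i$ is in the closure of $\{f_1,\dots,f_{i-1}\}$, $x_i=1$ otherwise. For a permutation $\sigma$ of $S$, $S_\sigma$ denotes $S$ with the linear order $\sigma(e_1)<\dots<\sigma(e_n)$, and $\lambda_M(\sigma)$ is the distinguished word of $M$ on $S_\sigma$. For $A,B\subseteq S$ with $|A|=|B|$, the shuffle $\sigma_{A,B}$ is the unique permutation of $S$ mapping $B$ onto $A$ and $S\setminus B$ onto $S\setminus A$ whose restrictions to $B$ and to $S\setminus B$ are order-preserving. -}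

module Defs where

open import Data.Nat as ℕ using (ℕ; _≤_)
open import Data.Bool using (Bool; true; false; not)
open import Data.Fin as Fin using (Fin; _<_; _<?_; _≟_)
open import Data.Fin.Properties using (any?)
open import Data.Fin.Subset using (Subset; _∈_; _∉_; _⊆_; _∪_; _∩_; ⊤; ⁅_⁆; ∣_∣)
open import Data.Vec using (Vec; lookup; tabulate)
open import Data.Product using (_×_; ∃)
open import Relation.Nullary using (Dec; yes; no; ⌊_⌋)
open import Relation.Nullary.Decidable using (_×-dec_)
open import Relation.Binary.PropositionalEquality using (_≡_)
open import Function.Bundles using (_⇔_)
open import Data.Fin.Permutation using (Permutation′; _⟨$⟩ʳ_)

-- A matroid on the ground set S = Fin n = {e_0 < ... < e_(n-1)}
-- given by its rank function (rank axioms R1–R3).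
record Matroid (n : ℕ) : Set where
  field
    rk          : Subset n → ℕ
    rk-bounded  : ∀ X → rk X ≤ ∣ X ∣
    rk-monotone : ∀ {X Y} → X ⊆ Y → rk X ≤ rk Y
    rk-submod   : ∀ X Y → rk (X ∪ Y) ℕ.+ rk (X ∩ Y) ≤ rk X ℕ.+ rk Y
open Matroid public

rank : ∀ {n} → Matroid n → ℕ
rank M = rk M ⊤

InClosure : ∀ {n} → Matroid n → Subset n → Fin n → Set
InClosure M X e = rk M (X ∪ ⁅ e ⁆) ≡ rk M X

inClosure? : ∀ {n} (M : Matroid n) X e → Dec (InClosure M X e)
inClosure? M X e = rk M (X ∪ ⁅ e ⁆) ℕ.≟ rk M X

-- Words of length n on {0,1}; true = 1, false = 0.
Word : ℕ → Set
Word n = Vec Bool n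

InW : ∀ {n} → ℕ → Word n → Set
InW r w = ∣ w ∣ ≡ r

onesBefore : ∀ {n} → Word n → Fin n → ℕ
onesBefore {ℕ.suc n} w Fin.zero = 0
onesBefore {ℕ.suc n} (b Data.Vec.∷ w) (Fin.suc i) =
  (if b then 1 else 0) ℕ.+ onesBefore w i
  where open import Data.Bool using (if_then_else_)

-- IsKthOne w k i : position i holds the (k+1)-th one of w  (i.e. π_{k+1}(w) = i,
-- with 0-based k and positions)
IsKthOne : ∀ {n} → Word n → ℕ → Fin n → Set
IsKthOne w k i = (lookup w i ≡ true) × (onesBefore w i ≡ k)

_≤W_ : ∀ {n} → Word n → Word n → Set
_≤W_ {n} v w = ∀ (k : ℕ) (i j : Fin n) → IsKthOne v k i → IsKthOne w k j → Fin.toℕ i ≤ Fin.toℕ j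

πset : ∀ {n} → Word n → Subset n
πset {n} w = tabulate (λ x → ⌊ ∃? x ⌋)
  where
  ∃? : (x : Fin n) → Dec (∃ λ k → IsKthOne w k x)
  ∃? x with lookup w x Data.Bool.≟ true
  ... | yes p = yes (onesBefore w x Data.Product., (p Data.Product., _≡_.refl))
  ... | no ¬p = no λ { (_ Data.Product., (p Data.Product., _)) → ¬p p }

prefix : ∀ {n} → (Fin n → Fin n) → Fin n → Subset n
prefix {n} σ i = tabulate (λ x → ⌊ any? (λ j → (j <? i) ×-dec (σ j ≟ x)) ⌋)

distWord : ∀ {n} → Matroid n → (Fin n → Fin n) → Word n
distWord M σ = tabulate (λ i → not ⌊ inClosure? M (prefix σ i) (σ i) ⌋)

wM : ∀ {n} → Matroid n → Word n
wM M = distWord M (λ i → i)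

λM : ∀ {n} → Matroid n → Permutation′ n → Word n
λM M σ = distWord M (σ ⟨$⟩ʳ_)

IsShuffle : ∀ {n} → Subset n → Subset n → Permutation′ n → Set
IsShuffle {n} A B σ =
  (∀ x → (x ∈ B) ⇔ ((σ ⟨$⟩ʳ x) ∈ A))
  × (∀ x y → x ∈ B → y ∈ B → x < y → (σ ⟨$⟩ʳ x) < (σ ⟨$⟩ʳ y))
  × (∀ x y → x ∉ B → y ∉ B → x < y → (σ ⟨$⟩ʳ x) < (σ ⟨$⟩ʳ y))

-- Let σ be the shuffle. It sends the k-th one of v to the k-th one of w = wM M and the k-th
-- zero of v to the k-th zero of w. As v ≤ w, the k-th one of v is not later than the k-th one
-- of w, so an index i with v i = 1 has at most as many zeros of v before it as σ i has zeros of
-- w before it. Consequently, if v i = 1 then σ j < σ i for all j < i, so σ i lies outside the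
-- closure of the σ-prefix before i, which sits inside {e < σ i}; and if v i = 0 then every one of
-- w before σ i is σ j for some j < i, and these ones span {e < σ i}, whose closure contains σ i.

module Submission where

open import Defs
open import Data.Nat using (ℕ)
open import Data.Fin.Permutation using (Permutation′)
open import Relation.Binary.PropositionalEquality using (_≡_)

open import Data.Nat using (zero; suc; _+_; _≤_; _<_; _<ᵇ_; z≤n; s≤s)
import Data.Nat.Properties as ℕ
open import Data.Bool using (Bool; true; false; not; _∧_; if_then_else_; T)
open import Data.Bool.Properties using (∧-zeroʳ; ⇔→≡; T-≡; not-injective)
open import Data.Fin using (Fin; toℕ; fromℕ<)
import Data.Fin as Fin
import Data.Fin.Properties as Fin
open import Data.Fin.Subset using (Subset; _∈_; _∉_; _⊆_; _∪_; _∩_; ⁅_⁆)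
open import Data.Fin.Subset.Properties
  using (⊆-refl; ⊆-trans; ⊆-antisym; x∈p∪q⁺; x∈p∪q⁻; x∈p∩q⁺; x∈p∩q⁻; p⊆p∪q; q⊆p∪q; p∩q⊆p; p∩q⊆q; x∈⁅x⁆; x∈⁅y⁆⇒x≡y)
open import Data.Vec using (lookup; tabulate; _∷_)
open import Data.Vec.Properties using (lookup∘tabulate; tabulate∘lookup; tabulate-cong; lookup⇒[]=; []=⇒lookup)
open import Data.Product using (∃; _×_; _,_; proj₁; proj₂)
open import Data.Sum using (inj₁; inj₂; [_,_]′)
open import Function using (_∘_; id)
open import Function.Bundles using (_⇔_; mk⇔; Equivalence)
open import Relation.Binary using (tri<; tri≈; tri>)
open import Relation.Binary.PropositionalEquality using (refl; sym; trans; cong; cong₂; subst; _≗_; module ≡-Reasoning)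
open import Relation.Nullary using (Dec; yes; no; _because_; ¬_; ⌊_⌋; contradiction)
open import Relation.Nullary.Decidable using (does-⇔)
open import Data.Fin.Permutation using (_⟨$⟩ʳ_; _⟨$⟩ˡ_; inverseʳ)
open import Algebra.Properties.CommutativeMonoid.Sum ℕ.+-0-commutativeMonoid using (sum; sum-permute; sum-cong-≗)

private
  variable
    n : ℕ

∈-tabulate⁺ : {f : Fin n → Bool} {x : Fin n} → f x ≡ true → x ∈ tabulate f
∈-tabulate⁺ {f = f} {x} fx = lookup⇒[]= x _ (trans (lookup∘tabulate f x) fx)

∈-tabulate⁻ : {f : Fin n → Bool} {x : Fin n} → x ∈ tabulate f → f x ≡ true
∈-tabulate⁻ {f = f} {x} x∈ = trans (sym (lookup∘tabulate f x)) ([]=⇒lookup x∈)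

module _ {p} {P : Set p} where

  isYes⁺ : (P? : Dec P) → P → ⌊ P? ⌋ ≡ true
  isYes⁺ (yes _) _  = refl
  isYes⁺ (no ¬p) p = contradiction p ¬p

  isYes⁻ : (P? : Dec P) → ⌊ P? ⌋ ≡ true → P
  isYes⁻ (yes p) _ = p

  isNo⁺ : (P? : Dec P) → ¬ P → ⌊ P? ⌋ ≡ false
  isNo⁺ (yes p) ¬p = contradiction p ¬p
  isNo⁺ (no _)  _  = refl

  isNo⁻ : (P? : Dec P) → ⌊ P? ⌋ ≡ false → ¬ P
  isNo⁻ (no ¬p) _ = ¬p

∈-tabulate-dec⁺ : ∀ {p} {P : Fin n → Set p} {P? : ∀ y → Dec (P y)} {x : Fin n}
                → P x → x ∈ tabulate (λ y → ⌊ P? y ⌋)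
∈-tabulate-dec⁺ {P? = P?} {x} px = ∈-tabulate⁺ (isYes⁺ (P? x) px)

∈-tabulate-dec⁻ : ∀ {p} {P : Fin n → Set p} {P? : ∀ y → Dec (P y)} {x : Fin n}
                → x ∈ tabulate (λ y → ⌊ P? y ⌋) → P x
∈-tabulate-dec⁻ {P? = P?} {x} x∈ = isYes⁻ (P? x) (∈-tabulate⁻ x∈)

∈prefix⁺ : (g : Fin n → Fin n) {i j : Fin n} → j Fin.< i → g j ∈ prefix g i
∈prefix⁺ g {j = j} j<i = ∈-tabulate-dec⁺ (j , j<i , refl)

∈prefix⁻ : (g : Fin n → Fin n) {i y : Fin n} → y ∈ prefix g i → ∃ λ j → j Fin.< i × g j ≡ y
∈prefix⁻ g y∈ = ∈-tabulate-dec⁻ y∈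

∈πset⁺ : (u : Word n) {x : Fin n} → lookup u x ≡ true → x ∈ πset u
∈πset⁺ u {x} ux = ∈-tabulate-dec⁺ (onesBefore u x , ux , refl)

∈πset⁻ : (u : Word n) {x : Fin n} → x ∈ πset u → lookup u x ≡ true
∈πset⁻ u x∈ = proj₁ (proj₂ (∈-tabulate-dec⁻ x∈))

∪-lub : {p q r : Subset n} → p ⊆ r → q ⊆ r → p ∪ q ⊆ r
∪-lub {p = p} {q} p⊆r q⊆r x∈ = [ p⊆r , q⊆r ]′ (x∈p∪q⁻ p q x∈)

∩-glb : {p q r : Subset n} → r ⊆ p → r ⊆ q → r ⊆ p ∩ q
∩-glb r⊆p r⊆q x∈ = x∈p∩q⁺ (r⊆p x∈ , r⊆q x∈)

⁅⁆-⊆ : {p : Subset n} {x : Fin n} → x ∈ p → ⁅ x ⁆ ⊆ p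
⁅⁆-⊆ {p = p} {x} x∈p y∈ = subst (_∈ p) (sym (x∈⁅y⁆⇒x≡y x y∈)) x∈p

∈-tabulate-T⁺ : {f : Fin n → Bool} {x : Fin n} → T (f x) → x ∈ tabulate f
∈-tabulate-T⁺ = ∈-tabulate⁺ ∘ Equivalence.to T-≡

∈-tabulate-T⁻ : {f : Fin n → Bool} {x : Fin n} → x ∈ tabulate f → T (f x)
∈-tabulate-T⁻ = Equivalence.from T-≡ ∘ ∈-tabulate⁻

Below : ℕ → Subset n
Below m = tabulate (λ y → toℕ y <ᵇ m)

∈Below⁺ : {m : ℕ} {y : Fin n} → toℕ y < m → y ∈ Below m
∈Below⁺ = ∈-tabulate-T⁺ ∘ ℕ.<⇒<ᵇ

∈Below⁻ : {m : ℕ} {y : Fin n} → y ∈ Below m → toℕ y < m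
∈Below⁻ = ℕ.<ᵇ⇒< _ _ ∘ ∈-tabulate-T⁻

Below-mono : {m m′ : ℕ} → m ≤ m′ → Below {n} m ⊆ Below m′
Below-mono m≤m′ y∈ = ∈Below⁺ (ℕ.<-≤-trans (∈Below⁻ y∈) m≤m′)

n≤m⇒⊆Below : {m : ℕ} → n ≤ m → {p : Subset n} → p ⊆ Below m
n≤m⇒⊆Below n≤m {x = y} _ = ∈Below⁺ (ℕ.<-≤-trans (Fin.toℕ<n y) n≤m)

prefix-id≡Below : (x : Fin n) → prefix id x ≡ Below (toℕ x)
prefix-id≡Below x = ⊆-antisym
  (λ y∈ → let (j , j<x , j≡y) = ∈prefix⁻ id y∈ in subst (_∈ Below (toℕ x)) j≡y (∈Below⁺ j<x))
  (λ y∈ → ∈prefix⁺ id (∈Below⁻ y∈))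

Below-suc-toℕ : (e : Fin n) → Below (suc (toℕ e)) ⊆ Below (toℕ e) ∪ ⁅ e ⁆
Below-suc-toℕ e {y} y∈ with toℕ y ℕ.<? toℕ e
... | yes y<e = x∈p∪q⁺ (inj₁ (∈Below⁺ y<e))
... | no  y≮e = x∈p∪q⁺ (inj₂ (subst (_∈ ⁅ e ⁆) (sym y≡e) (x∈⁅x⁆ e)))
  where
  y≡e : y ≡ e
  y≡e = Fin.toℕ-injective (ℕ.≤-antisym (ℕ.≤-pred (∈Below⁻ y∈)) (ℕ.≮⇒≥ y≮e))

<ᵇ-cong : {a b c d : ℕ} → a < b ⇔ c < d → (a <ᵇ b) ≡ (c <ᵇ d)
<ᵇ-cong {a} {b} {c} {d} a<b⇔c<d =
  does-⇔ a<b⇔c<d (_ because ℕ.<ᵇ-reflects-< a b) (_ because ℕ.<ᵇ-reflects-< c d)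

count : (Fin n → Bool) → ℕ
count f = sum (λ x → if f x then 1 else 0)

count-cong : {f g : Fin n → Bool} → f ≗ g → count f ≡ count g
count-cong f≗g = sum-cong-≗ (cong (λ b → if b then 1 else 0) ∘ f≗g)

count-permute : (σ : Permutation′ n) (f : Fin n → Bool) → count f ≡ count (f ∘ (σ ⟨$⟩ʳ_))
count-permute σ f = sum-permute _ σ

countBelow : (Fin n → Bool) → ℕ → ℕ
countBelow f m = count (λ x → (toℕ x <ᵇ m) ∧ f x)

countBelow-zero : (f : Fin n → Bool) → countBelow f 0 ≡ 0
countBelow-zero {zero}  f = refl
countBelow-zero {suc n} f = countBelow-zero (f ∘ Fin.suc)

countBelow-complement : (f : Fin n → Bool) {m : ℕ} → m ≤ n →
                        countBelow f m + countBelow (not ∘ f) m ≡ m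
countBelow-complement f {zero} _ = cong₂ _+_ (countBelow-zero f) (countBelow-zero (not ∘ f))
countBelow-complement {suc n} f {suc m} (s≤s m≤n) with f Fin.zero
... | true  = cong suc (countBelow-complement (f ∘ Fin.suc) m≤n)
... | false = trans (ℕ.+-suc _ _) (cong suc (countBelow-complement (f ∘ Fin.suc) m≤n))

countBelow-mono : (f : Fin n → Bool) {m m′ : ℕ} → m ≤ m′ → countBelow f m ≤ countBelow f m′
countBelow-mono {zero}  f _ = z≤n
countBelow-mono {suc n} f {zero} _ = ℕ.≤-trans (ℕ.≤-reflexive (countBelow-zero f)) z≤n
countBelow-mono {suc n} f {suc m} {suc m′} (s≤s m≤m′) =
  ℕ.+-monoʳ-≤ (if f Fin.zero then 1 else 0) (countBelow-mono (f ∘ Fin.suc) m≤m′)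

countBelow-step : (f : Fin n → Bool) {x : Fin n} → f x ≡ true →
                  countBelow f (suc (toℕ x)) ≡ suc (countBelow f (toℕ x))
countBelow-step {suc n} f {Fin.zero} fx rewrite fx | countBelow-zero f = refl
countBelow-step {suc n} f {Fin.suc x} fx =
  trans (cong (_ +_) (countBelow-step (f ∘ Fin.suc) fx)) (ℕ.+-suc _ _)

countBelow-strict : (f : Fin n → Bool) {x y : Fin n} → f x ≡ true → x Fin.< y →
                    countBelow f (toℕ x) < countBelow f (toℕ y)
countBelow-strict f fx x<y =
  ℕ.≤-trans (ℕ.≤-reflexive (sym (countBelow-step f fx))) (countBelow-mono f x<y)

countBelow-cancel-< : (f : Fin n → Bool) {x y : Fin n} →
                      countBelow f (toℕ x) < countBelow f (toℕ y) → x Fin.< y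
countBelow-cancel-< f {x} {y} cx<cy with toℕ x ℕ.<? toℕ y
... | yes x<y = x<y
... | no  x≮y = contradiction (countBelow-mono f (ℕ.≮⇒≥ x≮y)) (ℕ.<⇒≱ cx<cy)

strictMonoOn-reflects : {P : Fin n → Set} (g : Fin n → Fin n) →
  (∀ {x y} → P x → P y → x Fin.< y → g x Fin.< g y) →
  ∀ {x y} → P x → P y → g x Fin.< g y → x Fin.< y
strictMonoOn-reflects g mono {x} {y} px py gx<gy with Fin.<-cmp x y
... | tri< x<y _ _ = x<y
... | tri≈ _ refl _ = contradiction gx<gy (Fin.<-irrefl refl)
... | tri> _ _ y<x = contradiction gx<gy (Fin.<-asym (mono py px y<x))

-- Reindex by σ; on the positions where p holds, σ preserves and reflects the order.
countBelow-shuffle : (σ : Permutation′ n) (p q : Fin n → Bool) →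
  (∀ x → p x ≡ q (σ ⟨$⟩ʳ x)) →
  (∀ {x y} → p x ≡ true → p y ≡ true → x Fin.< y → σ ⟨$⟩ʳ x Fin.< σ ⟨$⟩ʳ y) →
  ∀ {i} → p i ≡ true → countBelow q (toℕ (σ ⟨$⟩ʳ i)) ≡ countBelow p (toℕ i)
countBelow-shuffle σ p q p≡q∘σ mono {i} pi =
  trans (count-permute σ _) (count-cong pointwise)
  where
  pointwise : ∀ x → (toℕ (σ ⟨$⟩ʳ x) <ᵇ toℕ (σ ⟨$⟩ʳ i)) ∧ q (σ ⟨$⟩ʳ x) ≡ (toℕ x <ᵇ toℕ i) ∧ p x
  pointwise x rewrite sym (p≡q∘σ x) with p x in px
  ... | true  = cong (_∧ true) (<ᵇ-cong (mk⇔ (strictMonoOn-reflects (σ ⟨$⟩ʳ_) mono px pi) (mono px pi)))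
  ... | false = trans (∧-zeroʳ _) (sym (∧-zeroʳ _))

ones zeros : Word n → ℕ → ℕ
ones  u = countBelow (lookup u)
zeros u = countBelow (not ∘ lookup u)

onesBefore≡ones : (u : Word n) (i : Fin n) → onesBefore u i ≡ ones u (toℕ i)
onesBefore≡ones {suc n} u       Fin.zero    = sym (countBelow-zero (lookup u))
onesBefore≡ones {suc n} (b ∷ u) (Fin.suc i) = cong (_ +_) (onesBefore≡ones u i)

ones+zeros : (u : Word n) (x : Fin n) → ones u (toℕ x) + zeros u (toℕ x) ≡ toℕ x
ones+zeros u x = countBelow-complement (lookup u) (ℕ.<⇒≤ (Fin.toℕ<n x))

∉πset⁺ : (u : Word n) {x : Fin n} → lookup u x ≡ false → x ∉ πset u
∉πset⁺ u ux x∈ = contradiction (trans (sym ux) (∈πset⁻ u x∈)) λ ()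

module ShuffleOrder {v w : Word n} (v≤w : v ≤W w) {σ : Permutation′ n}
                    (shuffle : IsShuffle (πset w) (πset v) σ) where

  lookup-σ : ∀ x → lookup v x ≡ lookup w (σ ⟨$⟩ʳ x)
  lookup-σ x = ⇔→≡ (mk⇔ (∈πset⁻ w ∘ Equivalence.to   (proj₁ shuffle x) ∘ ∈πset⁺ v)
                         (∈πset⁻ v ∘ Equivalence.from (proj₁ shuffle x) ∘ ∈πset⁺ w))

  σ-mono-ones : ∀ {x y} → lookup v x ≡ true → lookup v y ≡ true → x Fin.< y →
                σ ⟨$⟩ʳ x Fin.< σ ⟨$⟩ʳ y
  σ-mono-ones vx vy = proj₁ (proj₂ shuffle) _ _ (∈πset⁺ v vx) (∈πset⁺ v vy)

  σ-mono-zeros : ∀ {x y} → not (lookup v x) ≡ true → not (lookup v y) ≡ true → x Fin.< y →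
                 σ ⟨$⟩ʳ x Fin.< σ ⟨$⟩ʳ y
  σ-mono-zeros vx vy =
    proj₂ (proj₂ shuffle) _ _ (∉πset⁺ v (not-injective vx)) (∉πset⁺ v (not-injective vy))

  ones-σ : ∀ {i} → lookup v i ≡ true → ones w (toℕ (σ ⟨$⟩ʳ i)) ≡ ones v (toℕ i)
  ones-σ = countBelow-shuffle σ (lookup v) (lookup w) lookup-σ σ-mono-ones

  zeros-σ : ∀ {i} → lookup v i ≡ false → zeros w (toℕ (σ ⟨$⟩ʳ i)) ≡ zeros v (toℕ i)
  zeros-σ vi = countBelow-shuffle σ (not ∘ lookup v) (not ∘ lookup w) (cong not ∘ lookup-σ)
                                  σ-mono-zeros (cong not vi)

  -- σ sends the k-th one of v to the k-th one of w, so v ≤W w applies.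
  ≤-σ : ∀ {i} → lookup v i ≡ true → toℕ i ≤ toℕ (σ ⟨$⟩ʳ i)
  ≤-σ {i} vi = v≤w (onesBefore v i) i (σ ⟨$⟩ʳ i) (vi , refl) (trans (sym (lookup-σ i)) vi , same-rank)
    where
    open ≡-Reasoning
    same-rank : onesBefore w (σ ⟨$⟩ʳ i) ≡ onesBefore v i
    same-rank = begin
      onesBefore w (σ ⟨$⟩ʳ i)  ≡⟨ onesBefore≡ones w (σ ⟨$⟩ʳ i) ⟩
      ones w (toℕ (σ ⟨$⟩ʳ i))  ≡⟨ ones-σ vi ⟩
      ones v (toℕ i)           ≡⟨ onesBefore≡ones v i ⟨
      onesBefore v i           ∎

  zeros-≤-σ : ∀ {i} → lookup v i ≡ true → zeros v (toℕ i) ≤ zeros w (toℕ (σ ⟨$⟩ʳ i))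
  zeros-≤-σ {i} vi = ℕ.+-cancelˡ-≤ (ones v (toℕ i)) _ _ (begin
    ones v (toℕ i) + zeros v (toℕ i)                    ≡⟨ ones+zeros v i ⟩
    toℕ i                                               ≤⟨ ≤-σ vi ⟩
    toℕ (σ ⟨$⟩ʳ i)                                      ≡⟨ ones+zeros w (σ ⟨$⟩ʳ i) ⟨
    ones w (toℕ (σ ⟨$⟩ʳ i)) + zeros w (toℕ (σ ⟨$⟩ʳ i))  ≡⟨ cong (_+ _) (ones-σ vi) ⟩
    ones v (toℕ i) + zeros w (toℕ (σ ⟨$⟩ʳ i))           ∎)
    where open ℕ.≤-Reasoning

  σ-mono-at-one : ∀ {i j} → lookup v i ≡ true → j Fin.< i → σ ⟨$⟩ʳ j Fin.< σ ⟨$⟩ʳ i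
  σ-mono-at-one {i} {j} vi j<i with lookup v j in vj
  ... | true  = σ-mono-ones vj vi j<i
  ... | false = countBelow-cancel-< (not ∘ lookup w) (begin-strict
    zeros w (toℕ (σ ⟨$⟩ʳ j))  ≡⟨ zeros-σ vj ⟩
    zeros v (toℕ j)           <⟨ countBelow-strict (not ∘ lookup v) (cong not vj) j<i ⟩
    zeros v (toℕ i)           ≤⟨ zeros-≤-σ vi ⟩
    zeros w (toℕ (σ ⟨$⟩ʳ i))  ∎)
    where open ℕ.≤-Reasoning

  σ-reflects-at-zero : ∀ {i j} → lookup v i ≡ false → lookup v j ≡ true →
                       σ ⟨$⟩ʳ j Fin.< σ ⟨$⟩ʳ i → j Fin.< i
  σ-reflects-at-zero {i} {j} vi vj σj<σi with Fin.<-cmp j i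
  ... | tri< j<i _ _ = j<i
  ... | tri≈ _ refl _ = contradiction (trans (sym vi) vj) λ ()
  ... | tri> _ _ i<j = contradiction (begin-strict
    zeros v (toℕ i)           <⟨ countBelow-strict (not ∘ lookup v) (cong not vi) i<j ⟩
    zeros v (toℕ j)           ≤⟨ zeros-≤-σ vj ⟩
    zeros w (toℕ (σ ⟨$⟩ʳ j))  ≤⟨ countBelow-mono (not ∘ lookup w) (ℕ.<⇒≤ σj<σi) ⟩
    zeros w (toℕ (σ ⟨$⟩ʳ i))  ≡⟨ zeros-σ vi ⟩
    zeros v (toℕ i)           ∎) (ℕ.<-irrefl refl)
    where open ℕ.≤-Reasoning

  prefix⊆Below : ∀ {i} → lookup v i ≡ true → prefix (σ ⟨$⟩ʳ_) i ⊆ Below (toℕ (σ ⟨$⟩ʳ i))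
  prefix⊆Below {i} vi y∈ =
    let (j , j<i , σj≡y) = ∈prefix⁻ _ y∈
    in  subst (_∈ Below (toℕ (σ ⟨$⟩ʳ i))) σj≡y (∈Below⁺ (σ-mono-at-one vi j<i))

  πset∩Below⊆prefix : ∀ {i} → lookup v i ≡ false →
                      πset w ∩ Below (toℕ (σ ⟨$⟩ʳ i)) ⊆ prefix (σ ⟨$⟩ʳ_) i
  πset∩Below⊆prefix {i} vi {y} y∈ with x∈p∩q⁻ (πset w) _ y∈
  ... | y∈πw , y∈Below =
    subst (_∈ prefix _ i) σj≡y (∈prefix⁺ _ (σ-reflects-at-zero vi vj σj<σi))
    where
    σj≡y : σ ⟨$⟩ʳ (σ ⟨$⟩ˡ y) ≡ y
    σj≡y = inverseʳ σ
    vj : lookup v (σ ⟨$⟩ˡ y) ≡ true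
    vj = trans (lookup-σ _) (subst (λ z → lookup w z ≡ true) (sym σj≡y) (∈πset⁻ w y∈πw))
    σj<σi : σ ⟨$⟩ʳ (σ ⟨$⟩ˡ y) Fin.< σ ⟨$⟩ʳ i
    σj<σi = subst (λ z → toℕ z < toℕ (σ ⟨$⟩ʳ i)) (sym σj≡y) (∈Below⁻ y∈Below)

module _ (M : Matroid n) where

  ≤⇒InClosure : ∀ {X e} → rk M (X ∪ ⁅ e ⁆) ≤ rk M X → InClosure M X e
  ≤⇒InClosure le = ℕ.≤-antisym le (rk-monotone M (p⊆p∪q _))

  -- Submodularity applied to X and Y ∪ Z, whose intersection contains Y.
  rk-∪-spanning : ∀ {X Y} Z → Y ⊆ X → rk M X ≤ rk M Y → rk M (X ∪ Z) ≤ rk M (Y ∪ Z)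
  rk-∪-spanning {X} {Y} Z Y⊆X rkX≤rkY = ℕ.+-cancelʳ-≤ (rk M Y) _ _ (begin
    rk M (X ∪ Z) + rk M Y                    ≤⟨ ℕ.+-mono-≤ (rk-monotone M X∪Z⊆) (rk-monotone M Y⊆) ⟩
    rk M (X ∪ (Y ∪ Z)) + rk M (X ∩ (Y ∪ Z))  ≤⟨ rk-submod M X (Y ∪ Z) ⟩
    rk M X + rk M (Y ∪ Z)                    ≤⟨ ℕ.+-monoˡ-≤ _ rkX≤rkY ⟩
    rk M Y + rk M (Y ∪ Z)                    ≡⟨ ℕ.+-comm (rk M Y) _ ⟩
    rk M (Y ∪ Z) + rk M Y                    ∎)
    where
    open ℕ.≤-Reasoning
    X∪Z⊆ : X ∪ Z ⊆ X ∪ (Y ∪ Z)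
    X∪Z⊆ = ∪-lub (p⊆p∪q _) (⊆-trans (q⊆p∪q Y Z) (q⊆p∪q X _))
    Y⊆ : Y ⊆ X ∩ (Y ∪ Z)
    Y⊆ = ∩-glb Y⊆X (p⊆p∪q Z)

  closure-mono : ∀ {X Y e} → X ⊆ Y → InClosure M X e → InClosure M Y e
  closure-mono {X} {Y} {e} X⊆Y e∈clX = ≤⇒InClosure (begin
    rk M (Y ∪ ⁅ e ⁆)          ≤⟨ rk-monotone M (∪-lub (q⊆p∪q (X ∪ ⁅ e ⁆) Y)
                                                 (⊆-trans (q⊆p∪q X ⁅ e ⁆) (p⊆p∪q Y))) ⟩
    rk M ((X ∪ ⁅ e ⁆) ∪ Y)    ≤⟨ rk-∪-spanning Y (p⊆p∪q _) (ℕ.≤-reflexive e∈clX) ⟩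
    rk M (X ∪ Y)              ≤⟨ rk-monotone M (∪-lub X⊆Y ⊆-refl) ⟩
    rk M Y                    ∎)
    where open ℕ.≤-Reasoning

  closure-spanning : ∀ {X Y e} → Y ⊆ X → rk M X ≤ rk M Y → InClosure M X e → InClosure M Y e
  closure-spanning {X} {Y} {e} Y⊆X rkX≤rkY e∈clX = ≤⇒InClosure (begin
    rk M (Y ∪ ⁅ e ⁆)  ≤⟨ rk-monotone M (∪-lub (⊆-trans Y⊆X (p⊆p∪q _)) (q⊆p∪q X _)) ⟩
    rk M (X ∪ ⁅ e ⁆)  ≡⟨ e∈clX ⟩
    rk M X            ≤⟨ rkX≤rkY ⟩
    rk M Y            ∎)
    where open ℕ.≤-Reasoning

  distWord-one : (g : Fin n → Fin n) {i : Fin n} →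
                 lookup (distWord M g) i ≡ true → ¬ InClosure M (prefix g i) (g i)
  distWord-one g {i} gi =
    isNo⁻ (inClosure? M _ _) (not-injective {y = false} (trans (sym (lookup∘tabulate _ i)) gi))

  distWord-zero : (g : Fin n → Fin n) {i : Fin n} →
                  lookup (distWord M g) i ≡ false → InClosure M (prefix g i) (g i)
  distWord-zero g {i} gi =
    isYes⁻ (inClosure? M _ _) (not-injective {y = true} (trans (sym (lookup∘tabulate _ i)) gi))

  distWord-unique : (g : Fin n → Fin n) {u : Word n} →
    (∀ i → lookup u i ≡ true → ¬ InClosure M (prefix g i) (g i)) →
    (∀ i → lookup u i ≡ false → InClosure M (prefix g i) (g i)) →
    distWord M g ≡ u
  distWord-unique g {u} at-one at-zero = trans (tabulate-cong pointwise) (tabulate∘lookup u)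
    where
    pointwise : ∀ i → not ⌊ inClosure? M (prefix g i) (g i) ⌋ ≡ lookup u i
    pointwise i with lookup u i in ui
    ... | true  = cong not (isNo⁺ _ (at-one i ui))
    ... | false = cong not (isYes⁺ _ (at-zero i ui))

  wM-one : {x : Fin n} → lookup (wM M) x ≡ true → ¬ InClosure M (Below (toℕ x)) x
  wM-one {x} = subst (λ X → ¬ InClosure M X x) (prefix-id≡Below x) ∘ distWord-one id

  wM-zero : {x : Fin n} → lookup (wM M) x ≡ false → InClosure M (Below (toℕ x)) x
  wM-zero {x} = subst (λ X → InClosure M X x) (prefix-id≡Below x) ∘ distWord-zero id

  ones-∩-Below-mono : ∀ {m m′} → m ≤ m′ → πset (wM M) ∩ Below m ⊆ πset (wM M) ∩ Below m′
  ones-∩-Below-mono m≤m′ = ∩-glb (p∩q⊆p _ _) (⊆-trans (p∩q⊆q _ _) (Below-mono m≤m′))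

  wM-ones-span-step : (e : Fin n) {m : ℕ} → toℕ e ≡ m →
    rk M (Below m) ≤ rk M (πset (wM M) ∩ Below m) →
    rk M (Below (suc m)) ≤ rk M (πset (wM M) ∩ Below (suc m))
  wM-ones-span-step e refl span with lookup (wM M) e in we
  ... | true = begin
    rk M (Below (suc (toℕ e)))                    ≤⟨ rk-monotone M (Below-suc-toℕ e) ⟩
    rk M (Below (toℕ e) ∪ ⁅ e ⁆)                  ≤⟨ rk-∪-spanning ⁅ e ⁆ (p∩q⊆q _ _) span ⟩
    rk M ((πset (wM M) ∩ Below (toℕ e)) ∪ ⁅ e ⁆)  ≤⟨ rk-monotone M (∪-lub (ones-∩-Below-mono (ℕ.n≤1+n _)) e⊆) ⟩
    rk M (πset (wM M) ∩ Below (suc (toℕ e)))      ∎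
    where
    open ℕ.≤-Reasoning
    e⊆ : ⁅ e ⁆ ⊆ πset (wM M) ∩ Below (suc (toℕ e))
    e⊆ = ⁅⁆-⊆ (x∈p∩q⁺ (∈πset⁺ (wM M) we , ∈Below⁺ ℕ.≤-refl))
  ... | false = begin
    rk M (Below (suc (toℕ e)))                ≤⟨ rk-monotone M (Below-suc-toℕ e) ⟩
    rk M (Below (toℕ e) ∪ ⁅ e ⁆)              ≡⟨ wM-zero we ⟩
    rk M (Below (toℕ e))                      ≤⟨ span ⟩
    rk M (πset (wM M) ∩ Below (toℕ e))        ≤⟨ rk-monotone M (ones-∩-Below-mono (ℕ.n≤1+n _)) ⟩
    rk M (πset (wM M) ∩ Below (suc (toℕ e)))  ∎
    where open ℕ.≤-Reasoning

  wM-ones-span : ∀ m → rk M (Below m) ≤ rk M (πset (wM M) ∩ Below m)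
  wM-ones-span zero    = rk-monotone M (λ y∈ → contradiction (∈Below⁻ y∈) ℕ.n≮0)
  wM-ones-span (suc m) with m ℕ.<? n
  ... | yes m<n = wM-ones-span-step (fromℕ< m<n) (Fin.toℕ-fromℕ< m<n) (wM-ones-span m)
  ... | no  m≮n = begin
    rk M (Below (suc m))                  ≤⟨ rk-monotone M (n≤m⇒⊆Below (ℕ.≮⇒≥ m≮n)) ⟩
    rk M (Below m)                        ≤⟨ wM-ones-span m ⟩
    rk M (πset (wM M) ∩ Below m)          ≤⟨ rk-monotone M (ones-∩-Below-mono (ℕ.n≤1+n m)) ⟩
    rk M (πset (wM M) ∩ Below (suc m))    ∎
    where open ℕ.≤-Reasoning

proposition7p3 : ∀ {n : ℕ} (M : Matroid n) (v : Word n)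
    → InW (rank M) v
    → v ≤W wM M
    → (σ : Permutation′ n)
    → IsShuffle (πset (wM M)) (πset v) σ
    → λM M σ ≡ v
proposition7p3 M v _ v≤w σ shuffle = distWord-unique M (σ ⟨$⟩ʳ_) independent dependent
  where
  open ShuffleOrder {v = v} {w = wM M} v≤w {σ = σ} shuffle

  independent : ∀ i → lookup v i ≡ true → ¬ InClosure M (prefix (σ ⟨$⟩ʳ_) i) (σ ⟨$⟩ʳ i)
  independent i vi = wM-one M (trans (sym (lookup-σ i)) vi) ∘ closure-mono M (prefix⊆Below vi)

  dependent : ∀ i → lookup v i ≡ false → InClosure M (prefix (σ ⟨$⟩ʳ_) i) (σ ⟨$⟩ʳ i)
  dependent i vi =
    closure-mono M (πset∩Below⊆prefix vi)
      (closure-spanning M (p∩q⊆q _ _) (wM-ones-span M (toℕ (σ ⟨$⟩ʳ i)))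
        (wM-zero M (trans (sym (lookup-σ i)) vi)))
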